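{- Let $q$ be a prime power and $d\ge 2$ an integer. Let $\Gamma^\ast$ be a divisible design graph on vertex set $V^\ast$ with parameters $$v^\ast = \frac{q^d (q^d - 1)}{q-1},\quad k^\ast = q^{d-1}(q^d - 1),\quad \lambda_1^\ast = q^{d-1}(q^d - q^{d-1} - 1),\quad \lambda_2^\ast = q^{d-2}(q-1)(q^d - 1),$$ whose canonical partition consists of $m^\ast=(q^d-1)/(q-1)$ classes $\mathcal{P}_1,\dots,\mathcal{P}_{m^\ast}$, each of size $n^\ast = q^d$. Let $\mathcal{D}^\ast=(\mathcal{P}^\ast,\mathcal{B}^\ast)$ be a symmetric $2$-$\left(\frac{q^d-1}{q-1},\, q^{d-1},\, q^{d-2}(q-1)\right)$ design, with point set $\mathcal{P}^\ast$ disjoint from $V^\ast$, and let $\phi$ be an arbitrary bijection from the set $\{\mathcal{P}_1,\dots,\mathcal{P}_{m^\ast}\}$ of canonical classes of $\Gamma^\ast$ to the block set $\mathcal{B}^\ast$. Define the graph $\Gamma$ with vertex set $V=V^\ast\cup\mathcal{P}^\ast$ as follows: two distinct vertices of $V^\ast$ are adjacent in $\Gamma$ if and only if they are adjacent in $\Gamma^\ast$; no two vertices of $\mathcal{P}^\ast$ are adjacent (so $\mathcal{P}^\ast$ is a coclique); and a vertex $x\in\mathcal{P}_i\subseteq V^\ast$ ($i\in\{1,\dots,m^\ast\}$) is adjacent to a vertex $y\in\mathcal{P}^\ast$ if and only if $y$ belongs to the block $\phi(\mathcal{P}_i)$. Then $\Gamma$ is a strongly regular graph with parameters $$\left(\frac{q^{2d}-1}{q-1},\;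 q^{2d-1},\; q^{2d-2}(q-1),\; q^{2d-2}(q-1)\right).$$
   Context: A $k$-regular graph on $v$ vertices is a divisible design graph with parameters $(v,k,\lambda_1,\lambda_2,m,n)$ if its vertex set can be partitioned into $m$ classes of size $n$ such that any two distinct vertices in the same class have exactly $\lambda_1$ common neighbours, and any two vertices in different classes have exactly $\lambda_2$ common neighbours (the graph being neither complete nor edgeless). Such a partition into classes is called a canonical partition. A symmetric $2$-$(v,k,\lambda)$ design is an incidence structure with $v$ points and $v$ blocks, each block containing $k$ points, and every pair of distinct points contained in exactly $\lambda$ blocks. A strongly regular graph with parameters $(v,k,\lambda,\mu)$ is a $k$-regular graph on $v$ vertices in which any two adjacent vertices have exactly $\lambda$ common neighbours and any two distinct non-adjacent vertices have exactly $\mu$ common neighbours. -}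

module Defs where

open import Data.Nat using (ℕ; _+_; _*_; _∸_; _^_; _≤_)
open import Data.Nat.Primality using (Prime)
open import Data.Fin using (Fin; splitAt)
open import Data.Fin.Properties using () renaming (_≟_ to _≟F_)
open import Data.Bool using (Bool; true; false; _∧_)
open import Data.List.Base using (length; filterᵇ; allFin)
open import Data.Sum using (_⊎_; inj₁; inj₂)
open import Data.Product using (Σ; ∃; _×_; ∃-syntax)
open import Relation.Binary.PropositionalEquality using (_≡_; _≢_)
open import Relation.Nullary.Decidable using (⌊_⌋)

IsPrimePower : ℕ → Set
IsPrimePower q = ∃[ p ] ∃[ e ] (Prime p × 1 ≤ e × q ≡ p ^ e)

count : ∀ {n} → (Fin n → Bool) → ℕ
count {n} P = length (filterᵇ P (allFin n))

Adj : ℕ → Set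
Adj n = Fin n → Fin n → Bool

IsSimple : ∀ {n} → Adj n → Set
IsSimple {n} A = (∀ x y → A x y ≡ A y x) × (∀ x → A x x ≡ false)

IsRegular : ∀ {n} → Adj n → ℕ → Set
IsRegular {n} A k = ∀ x → count (A x) ≡ k

common : ∀ {n} → Adj n → Fin n → Fin n → ℕ
common A x y = count (λ z → A x z ∧ A y z)

IsDDG : ∀ {v} → Adj v → (k λ₁ λ₂ m n : ℕ) → (Fin v → Fin m) → Set
IsDDG {v} A k λ₁ λ₂ m n cls =
  IsSimple A × IsRegular A k
  × (∀ (i : Fin m) → count (λ x → ⌊ cls x ≟F i ⌋) ≡ n)
  × (∀ x y → x ≢ y → cls x ≡ cls y → common A x y ≡ λ₁)
  × (∀ x y → cls x ≢ cls y → common A x y ≡ λ₂)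
  × (∃[ x ] ∃[ y ] (x ≢ y × A x y ≡ false))
  × (∃[ x ] ∃[ y ] (A x y ≡ true))

-- Symmetric 2-(v,k,λ) design: v points, v blocks, incidence I point block
IsSymDesign : ∀ {v} → (Fin v → Fin v → Bool) → (k lam : ℕ) → Set
IsSymDesign {v} I k lam =
  (∀ (B : Fin v) → count (λ x → I x B) ≡ k)
  × (∀ x y → x ≢ y → count (λ B → I x B ∧ I y B) ≡ lam)

IsSRG : ∀ {v} → Adj v → (k lam μ : ℕ) → Set
IsSRG {v} A k lam μ =
  IsSimple A × IsRegular A k
  × (∀ x y → x ≢ y → A x y ≡ true → common A x y ≡ lam)
  × (∀ x y → x ≢ y → A x y ≡ false → common A x y ≡ μ)

-- The construction: vertices Fin vs (the DDG) then Fin m (design points).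
adj⊎ : ∀ {vs m} → Adj vs → (Fin vs → Fin m) → (Fin m → Fin m → Bool)
     → (Fin m → Fin m) → Fin vs ⊎ Fin m → Fin vs ⊎ Fin m → Bool
adj⊎ A cls I φ (inj₁ a) (inj₁ b) = A a b
adj⊎ A cls I φ (inj₂ p) (inj₂ p′) = false
adj⊎ A cls I φ (inj₁ a) (inj₂ p) = I p (φ (cls a))
adj⊎ A cls I φ (inj₂ p) (inj₁ a) = I p (φ (cls a))

extAdj : ∀ {vs m} → Adj vs → (Fin vs → Fin m) → (Fin m → Fin m → Bool)
       → (Fin m → Fin m) → Adj (vs + m)
extAdj {vs} A cls I φ x y = adj⊎ A cls I φ (splitAt vs x) (splitAt vs y)

{-# OPTIONS --safe #-}
module Submission where

-- Every vertex of Γ* has exactly k*/m* = q^(d−1)(q−1) neighbours in each canonical class: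
-- the relation n*λ₁* + k* = n*λ₂* + λ₁* makes the number of 2-walks from any vertex into a
-- fixed class equal to n*λ₂*, so the class profiles N(·, j) satisfy
-- Σₐ N(a, j) N(a, l) = n*²λ₂* for all classes j, l, whence Σₐ (N(a, j) − N(a, l))² = 0.
-- In the symmetric design every point lies on k blocks, and two distinct blocks meet in
-- λ points, since the intersection sizes |X ∩ C| (C ≠ X) have mean λ and mean square λ².
-- Common neighbours in Γ split into those in V* and those in P*, which gives λ₁* + k,
-- λ₂* + λ, k · k*/m* and λ n* for the four kinds of pairs, all equal to q^(2d−2)(q−1);
-- the degrees k* + k and k n* both equal q^(2d−1).

open import Defs
open import Data.Nat using (ℕ; zero; suc; _+_; _*_; _∸_; _^_; _≤_; z≤n; s≤s; ∣_-_∣; nonTrivial⇒n>1; nonTrivial⇒nonZero)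
open import Data.Nat.Primality using (prime⇒nonTrivial)
open import Data.Nat.Properties
open import Data.Nat.Tactic.RingSolver using (solve; solve-∀)
open import Data.Fin using (Fin; zero; suc; splitAt; join; punchIn; punchOut)
open import Data.Fin.Properties using (punchIn-punchOut; join-splitAt; nonZeroIndex) renaming (_≟_ to _≟F_)
open import Data.Bool using (Bool; true; false; _∧_)
open import Data.Bool.Properties using (∧-comm; ∧-idem; ∧-zeroʳ)
open import Data.List using (_∷_; []; length; filterᵇ; tabulate)
open import Data.Sum using (_⊎_; inj₁; inj₂; map₁)
open import Data.Product using (_×_; _,_; proj₁; proj₂; ∃₂)
open import Data.Empty using (⊥-elim)
open import Function using (_∘_)
open import Function.Bundles using (_⤖_; Bijection)
open import Function.Properties.Bijection using (⤖⇒↔)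
open import Relation.Binary.PropositionalEquality
open import Relation.Nullary using (yes; no)
open import Relation.Nullary.Decidable using (⌊_⌋)
open import Algebra.Properties.CommutativeSemigroup *-commutativeSemigroup using (x∙yz≈y∙xz; x∙yz≈y∙zx)
open import Algebra.Properties.Semiring.Sum +-*-semiring
  using (sum-syntax; sum-cong-≗; ∑-comm; ∑-distrib-+; *-distribˡ-sum; *-distribʳ-sum; sum-remove; ∑-permute; sum-replicate-zero)
open ≡-Reasoning

⟦_⟧ : Bool → ℕ
⟦ true ⟧ = 1
⟦ false ⟧ = 0

⟦∧⟧ : ∀ a b → ⟦ a ∧ b ⟧ ≡ ⟦ a ⟧ * ⟦ b ⟧
⟦∧⟧ true true = refl
⟦∧⟧ true false = refl
⟦∧⟧ false b = refl

⟦⟧-idem : ∀ a → ⟦ a ⟧ * ⟦ a ⟧ ≡ ⟦ a ⟧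
⟦⟧-idem true = refl
⟦⟧-idem false = refl

count≡∑ : ∀ {n} (P : Fin n → Bool) → count P ≡ ∑[ i < n ] ⟦ P i ⟧
count≡∑ {n} P = go n (λ i → i)
  where
  go : ∀ k (g : Fin k → Fin n) → length (filterᵇ P (tabulate g)) ≡ ∑[ i < k ] ⟦ P (g i) ⟧
  go zero g = refl
  go (suc k) g with P (g zero)
  ... | true = cong suc (go k (g ∘ suc))
  ... | false = go k (g ∘ suc)

∑-const : ∀ n c → ∑[ i < n ] c ≡ n * c
∑-const zero c = refl
∑-const (suc n) c = cong (c +_) (∑-const n c)

∑-∧false : ∀ {n} (b : Fin n → Bool) → ∑[ i < n ] ⟦ b i ∧ false ⟧ ≡ 0
∑-∧false {n} b = trans (sum-cong-≗ (λ i → cong ⟦_⟧ (∧-zeroʳ (b i)))) (sum-replicate-zero n)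

∑-splitAt : ∀ a b (h : Fin a ⊎ Fin b → ℕ) →
            ∑[ x < a + b ] h (splitAt a x) ≡ ∑[ i < a ] h (inj₁ i) + ∑[ j < b ] h (inj₂ j)
∑-splitAt zero b h = refl
∑-splitAt (suc a) b h = trans (cong (h (inj₁ zero) +_) (∑-splitAt a b (h ∘ map₁ suc)))
                              (sym (+-assoc (h (inj₁ zero)) _ _))

∑-≡0 : ∀ {n} (f : Fin n → ℕ) → ∑[ i < n ] f i ≡ 0 → ∀ i → f i ≡ 0
∑-≡0 f eq zero = m+n≡0⇒m≡0 (f zero) eq
∑-≡0 f eq (suc i) = ∑-≡0 (f ∘ suc) (m+n≡0⇒n≡0 (f zero) eq) i

δ : ∀ {n} → Fin n → Fin n → ℕ
δ i j = ⟦ ⌊ i ≟F j ⌋ ⟧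

δ-refl : ∀ {n} (i : Fin n) → δ i i ≡ 1
δ-refl i with i ≟F i
... | yes _ = refl
... | no i≢i = ⊥-elim (i≢i refl)

δ-suc : ∀ {n} (i j : Fin n) → δ (suc i) (suc j) ≡ δ i j
δ-suc i j with i ≟F j
... | yes _ = refl
... | no _ = refl

∑-δ : ∀ {n} (i : Fin n) (f : Fin n → ℕ) → ∑[ j < n ] (δ i j * f j) ≡ f i
∑-δ {suc n} zero f = trans (cong₂ _+_ (+-identityʳ (f zero)) (sum-replicate-zero n)) (+-identityʳ _)
∑-δ {suc n} (suc i) f = trans (sum-cong-≗ (λ j → cong (_* f (suc j)) (δ-suc i j))) (∑-δ i (f ∘ suc))

∑-fibres : ∀ {n m} (c : Fin n → Fin m) (h : Fin m → ℕ) (g : Fin n → ℕ) →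
           ∑[ x < n ] (h (c x) * g x) ≡ ∑[ j < m ] (h j * ∑[ x < n ] (δ (c x) j * g x))
∑-fibres {n} {m} c h g = begin
  ∑[ x < n ] (h (c x) * g x)
    ≡⟨ sum-cong-≗ (λ x → sym (∑-δ (c x) (λ j → h j * g x))) ⟩
  ∑[ x < n ] ∑[ j < m ] (δ (c x) j * (h j * g x))
    ≡⟨ ∑-comm (λ x j → δ (c x) j * (h j * g x)) ⟩
  ∑[ j < m ] ∑[ x < n ] (δ (c x) j * (h j * g x))
    ≡⟨ sum-cong-≗ (λ j → sum-cong-≗ (λ x → x∙yz≈y∙xz (δ (c x) j) (h j) (g x))) ⟩
  ∑[ j < m ] ∑[ x < n ] (h j * (δ (c x) j * g x))
    ≡⟨ sum-cong-≗ (λ j → *-distribˡ-sum (h j) (λ x → δ (c x) j * g x)) ⟨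
  ∑[ j < m ] (h j * ∑[ x < n ] (δ (c x) j * g x)) ∎

∑-except : ∀ {n} (i : Fin n) (w f : Fin n → ℕ) c → (∀ j → j ≢ i → w j * f j ≡ w j * c) →
           ∑[ j < n ] (w j * f j) + w i * c ≡ ∑[ j < n ] w j * c + w i * f i
∑-except {n} i w f c off-i = begin
  ∑[ j < n ] (w j * f j) + w i * c
    ≡⟨ cong (_ +_) (sym (∑-δ i (λ j → w j * c))) ⟩
  ∑[ j < n ] (w j * f j) + ∑[ j < n ] (δ i j * (w j * c))
    ≡⟨ sym (∑-distrib-+ (λ j → w j * f j) (λ j → δ i j * (w j * c))) ⟩
  ∑[ j < n ] (w j * f j + δ i j * (w j * c))
    ≡⟨ sum-cong-≗ termwise ⟩
  ∑[ j < n ] (w j * c + δ i j * (w j * f j))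
    ≡⟨ ∑-distrib-+ (λ j → w j * c) (λ j → δ i j * (w j * f j)) ⟩
  ∑[ j < n ] (w j * c) + ∑[ j < n ] (δ i j * (w j * f j))
    ≡⟨ cong₂ _+_ (sym (*-distribʳ-sum c w)) (∑-δ i (λ j → w j * f j)) ⟩
  ∑[ j < n ] w j * c + w i * f i ∎
  where
  termwise : ∀ j → w j * f j + δ i j * (w j * c) ≡ w j * c + δ i j * (w j * f j)
  termwise j with i ≟F j
  ... | yes refl = swap (w i * f i) (w i * c)
    where
    swap : ∀ a b → a + 1 * b ≡ b + 1 * a
    swap = solve-∀
  ... | no i≢j = cong (_+ 0) (off-i j (i≢j ∘ sym))

square-distance : ∀ m n → m * m + n * n ≡ 2 * (m * n) + ∣ m - n ∣ * ∣ m - n ∣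
square-distance zero n = refl
square-distance (suc m) zero = zero-case (suc m)
  where
  zero-case : ∀ m → m * m + 0 ≡ 2 * (m * 0) + m * m
  zero-case = solve-∀
square-distance (suc m) (suc n) = begin
  suc m * suc m + suc n * suc n      ≡⟨ solve (m ∷ n ∷ []) ⟩
  m * m + n * n + 2 * (m + n + 1)    ≡⟨ cong (_+ 2 * (m + n + 1)) (square-distance m n) ⟩
  2 * (m * n) + D + 2 * (m + n + 1)  ≡⟨ expand m n D ⟩
  2 * (suc m * suc n) + D            ∎
  where
  D = ∣ m - n ∣ * ∣ m - n ∣
  expand : ∀ m n D → 2 * (m * n) + D + 2 * (m + n + 1) ≡ 2 * (suc m * suc n) + D
  expand = solve-∀

∑-squares-tight : ∀ {n} (f g : Fin n → ℕ) →
                  ∑[ i < n ] (f i * f i) + ∑[ i < n ] (g i * g i) ≡ 2 * ∑[ i < n ] (f i * g i) →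
                  ∀ i → f i ≡ g i
∑-squares-tight {n} f g balanced i = ∣m-n∣≡0⇒m≡n (square≡0 (∑-≡0 d² ∑d²≡0 i))
  where
  d² : Fin n → ℕ
  d² i = ∣ f i - g i ∣ * ∣ f i - g i ∣
  ∑d²≡0 : ∑[ i < n ] d² i ≡ 0
  ∑d²≡0 = +-cancelˡ-≡ (2 * ∑[ i < n ] (f i * g i)) _ 0 (begin
    2 * ∑[ i < n ] (f i * g i) + ∑[ i < n ] d² i
      ≡⟨ cong (_+ ∑[ i < n ] d² i) (*-distribˡ-sum 2 (λ i → f i * g i)) ⟩
    ∑[ i < n ] (2 * (f i * g i)) + ∑[ i < n ] d² i
      ≡⟨ sym (∑-distrib-+ (λ i → 2 * (f i * g i)) d²) ⟩
    ∑[ i < n ] (2 * (f i * g i) + d² i)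
      ≡⟨ sym (sum-cong-≗ (λ i → square-distance (f i) (g i))) ⟩
    ∑[ i < n ] (f i * f i + g i * g i)
      ≡⟨ ∑-distrib-+ (λ i → f i * f i) (λ i → g i * g i) ⟩
    ∑[ i < n ] (f i * f i) + ∑[ i < n ] (g i * g i)
      ≡⟨ balanced ⟩
    2 * ∑[ i < n ] (f i * g i)
      ≡⟨ +-identityʳ _ ⟨
    2 * ∑[ i < n ] (f i * g i) + 0 ∎)
  square≡0 : ∀ {m} → m * m ≡ 0 → m ≡ 0
  square≡0 {zero} _ = refl

∑-moments-const : ∀ {n} (f : Fin n → ℕ) c →
                  ∑[ i < n ] f i ≡ n * c → ∑[ i < n ] (f i * f i) ≡ n * (c * c) → ∀ i → f i ≡ c
∑-moments-const {n} f c ∑f ∑f² = ∑-squares-tight f (λ _ → c) (begin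
  ∑[ i < n ] (f i * f i) + ∑[ i < n ] (c * c)  ≡⟨ cong₂ _+_ ∑f² (∑-const n (c * c)) ⟩
  n * (c * c) + n * (c * c)                   ≡⟨ solve (n ∷ c ∷ []) ⟩
  2 * (n * c * c)                             ≡⟨ cong (λ s → 2 * (s * c)) ∑f ⟨
  2 * (∑[ i < n ] f i * c)                    ≡⟨ cong (2 *_) (*-distribʳ-sum c f) ⟩
  2 * ∑[ i < n ] (f i * c)                    ∎)

∑-moments-except : ∀ {n} (f : Fin n → ℕ) i c →
                   ∑[ j < n ] f j + c ≡ f i + n * c →
                   ∑[ j < n ] (f j * f j) + c * c ≡ f i * f i + n * (c * c) →
                   ∀ j → j ≢ i → f j ≡ c
∑-moments-except {suc n} f i c ∑f ∑f² j j≢i =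
  subst (λ j → f j ≡ c) (punchIn-punchOut (j≢i ∘ sym))
        (∑-moments-const (f ∘ punchIn i) c (remainder f ∑f) (remainder (λ j → f j * f j) ∑f²)
                         (punchOut (j≢i ∘ sym)))
  where
  remainder : ∀ (g : Fin (suc n) → ℕ) {d} → ∑[ j < suc n ] g j + d ≡ g i + suc n * d →
              ∑[ j < n ] g (punchIn i j) ≡ n * d
  remainder g {d} eq = +-cancelˡ-≡ (g i) _ _ (+-cancelʳ-≡ d _ _ (begin
    g i + ∑[ j < n ] g (punchIn i j) + d  ≡⟨ cong (_+ d) (sum-remove g) ⟨
    ∑[ j < suc n ] g j + d                ≡⟨ eq ⟩
    g i + (d + n * d)                     ≡⟨ cong (g i +_) (+-comm d (n * d)) ⟩
    g i + (n * d + d)                     ≡⟨ +-assoc (g i) (n * d) d ⟨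
    g i + n * d + d                       ∎))

δ-cong : ∀ {n} {i j : Fin n} {x y} → (i ≡ j → x ≡ y) → δ i j * x ≡ δ i j * y
δ-cong {i = i} {j} x≡y with i ≟F j
... | yes i≡j = cong (_+ 0) (x≡y i≡j)
... | no _ = refl

∑-transpose : ∀ {p q} (N : Fin p → Fin q → ℕ) (u : Fin p → ℕ) (g : Fin q → ℕ) →
              ∑[ C < q ] (g C * ∑[ t < p ] (u t * N t C)) ≡ ∑[ t < p ] (u t * ∑[ C < q ] (N t C * g C))
∑-transpose {p} {q} N u g = begin
  ∑[ C < q ] (g C * ∑[ t < p ] (u t * N t C))   ≡⟨ sum-cong-≗ (λ C → *-distribˡ-sum (g C) (λ t → u t * N t C)) ⟩
  ∑[ C < q ] ∑[ t < p ] (g C * (u t * N t C))   ≡⟨ ∑-comm (λ C t → g C * (u t * N t C)) ⟩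
  ∑[ t < p ] ∑[ C < q ] (g C * (u t * N t C))   ≡⟨ sum-cong-≗ (λ t → sum-cong-≗ (λ C → x∙yz≈y∙zx (g C) (u t) (N t C))) ⟩
  ∑[ t < p ] ∑[ C < q ] (u t * (N t C * g C))   ≡⟨ sum-cong-≗ (λ t → *-distribˡ-sum (u t) (λ C → N t C * g C)) ⟨
  ∑[ t < p ] (u t * ∑[ C < q ] (N t C * g C))   ∎

module DivisibleDesignGraph {v} (A : Adj v) {k λ₁ λ₂ m n : ℕ} {cls : Fin v → Fin m}
       (ddg : IsDDG A k λ₁ λ₂ m n cls) where

  adj : Fin v → Fin v → ℕ
  adj x y = ⟦ A x y ⟧

  neighboursIn : Fin v → Fin m → ℕ
  neighboursIn a j = ∑[ w < v ] (δ (cls w) j * adj a w)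

  adj-sym : ∀ x y → adj x y ≡ adj y x
  adj-sym x y = cong ⟦_⟧ (proj₁ (proj₁ ddg) x y)

  degree : ∀ a → ∑[ w < v ] adj a w ≡ k
  degree a = trans (sym (count≡∑ (A a))) (proj₁ (proj₂ ddg) a)

  class-size : ∀ j → ∑[ w < v ] δ (cls w) j ≡ n
  class-size j = trans (sym (count≡∑ (λ w → ⌊ cls w ≟F j ⌋))) (proj₁ (proj₂ (proj₂ ddg)) j)

  common-same : ∀ x y → x ≢ y → cls x ≡ cls y → common A x y ≡ λ₁
  common-same = proj₁ (proj₂ (proj₂ (proj₂ ddg)))

  common-other : ∀ x y → cls x ≢ cls y → common A x y ≡ λ₂
  common-other = proj₁ (proj₂ (proj₂ (proj₂ (proj₂ ddg))))

  common≡∑ : ∀ x y → common A x y ≡ ∑[ z < v ] (adj x z * adj y z)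
  common≡∑ x y = trans (count≡∑ (λ z → A x z ∧ A y z)) (sum-cong-≗ (λ z → ⟦∧⟧ (A x z) (A y z)))

  common-self : ∀ x → common A x x ≡ k
  common-self x = trans (count≡∑ (λ z → A x z ∧ A x z))
                        (trans (sum-cong-≗ (λ z → cong ⟦_⟧ (∧-idem (A x z)))) (degree x))

  adj-selfAdjoint : ∀ (g h : Fin v → ℕ) →
                    ∑[ a < v ] (g a * ∑[ w < v ] (h w * adj a w)) ≡ ∑[ w < v ] (h w * ∑[ a < v ] (adj w a * g a))
  adj-selfAdjoint g h = trans (∑-transpose (λ w a → adj a w) h g)
                              (sum-cong-≗ (λ w → cong (h w *_) (sum-cong-≗ (λ a → cong (_* g a) (adj-sym a w)))))

  module _ (parameter-condition : n * λ₁ + k ≡ n * λ₂ + λ₁) where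

    ∑-common-over-class : ∀ x j → ∑[ b < v ] (δ (cls b) j * common A x b) ≡ n * λ₂
    ∑-common-over-class x j with cls x ≟F j
    ... | no cls-x≢j = begin
      ∑[ b < v ] (δ (cls b) j * common A x b)
        ≡⟨ sum-cong-≗ (λ b → δ-cong (λ cls-b≡j → common-other x b (λ e → cls-x≢j (trans e cls-b≡j)))) ⟩
      ∑[ b < v ] (δ (cls b) j * λ₂)
        ≡⟨ *-distribʳ-sum λ₂ (λ b → δ (cls b) j) ⟨
      ∑[ b < v ] δ (cls b) j * λ₂
        ≡⟨ cong (_* λ₂) (class-size j) ⟩
      n * λ₂ ∎
    ... | yes refl = +-cancelʳ-≡ λ₁ _ _ (begin
      ∑[ b < v ] (δ (cls b) (cls x) * common A x b) + λ₁
        ≡⟨ cong (_ +_) (δ-refl-* λ₁) ⟨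
      ∑[ b < v ] (δ (cls b) (cls x) * common A x b) + δ (cls x) (cls x) * λ₁
        ≡⟨ ∑-except x (λ b → δ (cls b) (cls x)) (common A x) λ₁
             (λ b b≢x → δ-cong (λ same → common-same x b (b≢x ∘ sym) (sym same))) ⟩
      ∑[ b < v ] δ (cls b) (cls x) * λ₁ + δ (cls x) (cls x) * common A x x
        ≡⟨ cong₂ _+_ (cong (_* λ₁) (class-size (cls x))) (trans (δ-refl-* _) (common-self x)) ⟩
      n * λ₁ + k
        ≡⟨ parameter-condition ⟩
      n * λ₂ + λ₁ ∎)
      where
      δ-refl-* : ∀ y → δ (cls x) (cls x) * y ≡ y
      δ-refl-* y = trans (cong (_* y) (δ-refl (cls x))) (*-identityˡ y)

    ∑-neighboursIn-product : ∀ j l → ∑[ a < v ] (neighboursIn a j * neighboursIn a l) ≡ n * (n * λ₂)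
    ∑-neighboursIn-product j l = begin
      ∑[ a < v ] (neighboursIn a j * neighboursIn a l)
        ≡⟨ adj-selfAdjoint (λ a → neighboursIn a j) (λ w → δ (cls w) l) ⟩
      ∑[ w < v ] (δ (cls w) l * ∑[ a < v ] (adj w a * neighboursIn a j))
        ≡⟨ sum-cong-≗ (λ w → cong (δ (cls w) l *_) (walks w)) ⟩
      ∑[ w < v ] (δ (cls w) l * (n * λ₂))
        ≡⟨ *-distribʳ-sum (n * λ₂) (λ w → δ (cls w) l) ⟨
      ∑[ w < v ] δ (cls w) l * (n * λ₂)
        ≡⟨ cong (_* (n * λ₂)) (class-size l) ⟩
      n * (n * λ₂) ∎
      where
      walks : ∀ w → ∑[ a < v ] (adj w a * neighboursIn a j) ≡ n * λ₂
      walks w = begin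
        ∑[ a < v ] (adj w a * neighboursIn a j)
          ≡⟨ adj-selfAdjoint (adj w) (λ b → δ (cls b) j) ⟩
        ∑[ b < v ] (δ (cls b) j * ∑[ a < v ] (adj b a * adj w a))
          ≡⟨ sum-cong-≗ (λ b → cong (δ (cls b) j *_)
               (trans (sum-cong-≗ (λ a → *-comm (adj b a) (adj w a))) (sym (common≡∑ w b)))) ⟩
        ∑[ b < v ] (δ (cls b) j * common A w b)
          ≡⟨ ∑-common-over-class w j ⟩
        n * λ₂ ∎

    neighboursIn-balanced : ∀ a j l → neighboursIn a j ≡ neighboursIn a l
    neighboursIn-balanced a j l = ∑-squares-tight (λ a → neighboursIn a j) (λ a → neighboursIn a l) (begin
      ∑[ a < v ] (neighboursIn a j * neighboursIn a j) + ∑[ a < v ] (neighboursIn a l * neighboursIn a l)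
        ≡⟨ cong₂ _+_ (∑-neighboursIn-product j j) (∑-neighboursIn-product l l) ⟩
      n * (n * λ₂) + n * (n * λ₂)
        ≡⟨ cong (n * (n * λ₂) +_) (+-identityʳ _) ⟨
      2 * (n * (n * λ₂))
        ≡⟨ cong (2 *_) (∑-neighboursIn-product j l) ⟨
      2 * ∑[ a < v ] (neighboursIn a j * neighboursIn a l) ∎) a

    neighboursIn-uniform : ∀ a j → m * neighboursIn a j ≡ k
    neighboursIn-uniform a j = begin
      m * neighboursIn a j                          ≡⟨ ∑-const m _ ⟨
      ∑[ l < m ] neighboursIn a j                   ≡⟨ sum-cong-≗ (neighboursIn-balanced a j) ⟩
      ∑[ l < m ] neighboursIn a l                   ≡⟨ ∑-comm (λ l w → δ (cls w) l * adj a w) ⟩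
      ∑[ w < v ] ∑[ l < m ] (δ (cls w) l * adj a w)  ≡⟨ sum-cong-≗ (λ w → ∑-δ (cls w) (λ _ → adj a w)) ⟩
      ∑[ w < v ] adj a w                            ≡⟨ degree a ⟩
      k                                             ∎

∑-gram : ∀ {p q} (N : Fin p → Fin q → ℕ) (u : Fin p → ℕ) →
         ∑[ C < q ] (∑[ t < p ] (u t * N t C) * ∑[ t < p ] (u t * N t C)) ≡
         ∑[ t < p ] (u t * ∑[ t′ < p ] (u t′ * ∑[ C < q ] (N t C * N t′ C)))
∑-gram {p} {q} N u = begin
  ∑[ C < q ] (S C * S C)
    ≡⟨ ∑-transpose N u S ⟩
  ∑[ t < p ] (u t * ∑[ C < q ] (N t C * S C))
    ≡⟨ sum-cong-≗ (λ t → cong (u t *_) (∑-transpose N u (N t))) ⟩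
  ∑[ t < p ] (u t * ∑[ t′ < p ] (u t′ * ∑[ C < q ] (N t′ C * N t C)))
    ≡⟨ sum-cong-≗ (λ t → cong (u t *_) (sum-cong-≗ (λ t′ →
         cong (u t′ *_) (sum-cong-≗ (λ C → *-comm (N t′ C) (N t C)))))) ⟩
  ∑[ t < p ] (u t * ∑[ t′ < p ] (u t′ * ∑[ C < q ] (N t C * N t′ C))) ∎
  where
  S : Fin q → ℕ
  S C = ∑[ t < p ] (u t * N t C)

affine-injective : ∀ {k l c a b} → 2 ≤ k → a * k + l ≡ c + a → b * k + l ≡ c + b → a ≡ b
affine-injective {suc (suc k)} {l} {c} {a} {b} (s≤s (s≤s z≤n)) eqa eqb =
  *-cancelʳ-≡ a b (suc k) (+-cancelʳ-≡ l _ _ (trans (drop-fixed a eqa) (sym (drop-fixed b eqb))))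
  where
  drop-fixed : ∀ x → x * suc (suc k) + l ≡ c + x → x * suc k + l ≡ c
  drop-fixed x eq = +-cancelʳ-≡ x _ _ (begin
    x * suc k + l + x      ≡⟨ solve (x ∷ k ∷ l ∷ []) ⟩
    x * suc (suc k) + l    ≡⟨ eq ⟩
    c + x                  ∎)

idempotent-scaling : ∀ {i g c d e} → i * i ≡ i → g + i * c ≡ d + i * e → i * g + i * c ≡ i * (d + e)
idempotent-scaling {i} {g} {c} {d} {e} ii≡i eq = begin
  i * g + i * c            ≡⟨ cong (λ j → i * g + j * c) ii≡i ⟨
  i * g + i * i * c        ≡⟨ solve (i ∷ g ∷ c ∷ []) ⟩
  i * (g + i * c)          ≡⟨ cong (i *_) eq ⟩
  i * (d + i * e)          ≡⟨ solve (i ∷ d ∷ e ∷ []) ⟩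
  i * d + i * i * e        ≡⟨ cong (λ j → i * d + j * e) ii≡i ⟩
  i * d + i * e            ≡⟨ *-distribˡ-+ i d e ⟨
  i * (d + e)              ∎

second-moment : ∀ S k l v → S + k * l ≡ k * (k * l + k) → k * k + l ≡ v * l + k →
                S + l * l ≡ k * k + v * (l * l)
second-moment S k l v ∑² identity = +-cancelʳ-≡ (k * l) _ _ (begin
  S + l * l + k * l          ≡⟨ solve (S ∷ k ∷ l ∷ []) ⟩
  S + k * l + l * l          ≡⟨ cong (_+ l * l) ∑² ⟩
  k * (k * l + k) + l * l    ≡⟨ solve (k ∷ l ∷ []) ⟩
  (k * k + l) * l + k * k    ≡⟨ cong (λ x → x * l + k * k) identity ⟩
  (v * l + k) * l + k * k    ≡⟨ solve (v ∷ k ∷ l ∷ []) ⟩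
  k * k + v * (l * l) + k * l ∎)

module SymmetricDesign {v} (I : Fin v → Fin v → Bool) {k lam : ℕ}
       (design : IsSymDesign I k lam) (2≤k : 2 ≤ k) where

  inc : Fin v → Fin v → ℕ
  inc x B = ⟦ I x B ⟧

  replication : Fin v → ℕ
  replication x = ∑[ B < v ] inc x B

  blocksThrough : Fin v → Fin v → ℕ
  blocksThrough x y = ∑[ B < v ] (inc x B * inc y B)

  block-size : ∀ B → ∑[ x < v ] inc x B ≡ k
  block-size B = trans (sym (count≡∑ (λ x → I x B))) (proj₁ design B)

  blocksThrough-≢ : ∀ {x y} → x ≢ y → blocksThrough x y ≡ lam
  blocksThrough-≢ {x} {y} x≢y =
    trans (sym (trans (count≡∑ (λ B → I x B ∧ I y B)) (sum-cong-≗ (λ B → ⟦∧⟧ (I x B) (I y B)))))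
          (proj₂ design x y x≢y)

  blocksThrough-self : ∀ x → blocksThrough x x ≡ replication x
  blocksThrough-self x = sum-cong-≗ (λ B → ⟦⟧-idem (I x B))

  replication-equation : ∀ x → replication x * k + lam ≡ v * lam + replication x
  replication-equation x = begin
    replication x * k + lam
      ≡⟨ cong (_+ lam) (sym ∑-blocksThrough) ⟩
    ∑[ y < v ] blocksThrough x y + lam
      ≡⟨ cong₂ _+_ (sum-cong-≗ {v} (λ y → sym (*-identityˡ (blocksThrough x y)))) (sym (*-identityˡ lam)) ⟩
    ∑[ y < v ] (1 * blocksThrough x y) + 1 * lam
      ≡⟨ ∑-except x (λ _ → 1) (blocksThrough x) lam (λ y y≢x → cong (1 *_) (blocksThrough-≢ (y≢x ∘ sym))) ⟩
    ∑[ y < v ] 1 * lam + 1 * blocksThrough x x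
      ≡⟨ cong₂ _+_ (cong (_* lam) (trans (∑-const v 1) (*-identityʳ v))) (*-identityˡ _) ⟩
    v * lam + blocksThrough x x
      ≡⟨ cong (v * lam +_) (blocksThrough-self x) ⟩
    v * lam + replication x ∎
    where
    ∑-blocksThrough : ∑[ y < v ] blocksThrough x y ≡ replication x * k
    ∑-blocksThrough = begin
      ∑[ y < v ] ∑[ B < v ] (inc x B * inc y B)  ≡⟨ ∑-comm (λ y B → inc x B * inc y B) ⟩
      ∑[ B < v ] ∑[ y < v ] (inc x B * inc y B)  ≡⟨ sum-cong-≗ (λ B → trans (sym (*-distribˡ-sum (inc x B) (λ y → inc y B)))
                                                                        (cong (inc x B *_) (block-size B))) ⟩
      ∑[ B < v ] (inc x B * k)                   ≡⟨ *-distribʳ-sum k (inc x) ⟨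
      replication x * k                          ∎

  replication≡k : ∀ x → replication x ≡ k
  replication≡k x = *-cancelˡ-≡ _ _ v {{nonZeroIndex x}} (begin
    v * replication x                  ≡⟨ ∑-const v _ ⟨
    ∑[ y < v ] replication x           ≡⟨ sum-cong-≗ (λ y → affine-injective 2≤k (replication-equation x) (replication-equation y)) ⟩
    ∑[ y < v ] ∑[ B < v ] inc y B      ≡⟨ ∑-comm (λ y B → inc y B) ⟩
    ∑[ B < v ] ∑[ y < v ] inc y B      ≡⟨ sum-cong-≗ block-size ⟩
    ∑[ B < v ] k                       ≡⟨ ∑-const v k ⟩
    v * k                              ∎)

  design-identity : Fin v → k * k + lam ≡ v * lam + k
  design-identity x = subst (λ r → r * k + lam ≡ v * lam + r) (replication≡k x) (replication-equation x)

  meet : Fin v → Fin v → ℕ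
  meet X C = ∑[ t < v ] (inc t X * inc t C)

  meet-self : ∀ X → meet X X ≡ k
  meet-self X = trans (sum-cong-≗ (λ t → ⟦⟧-idem (I t X))) (block-size X)

  ∑-meet : ∀ X → ∑[ C < v ] meet X C ≡ k * k
  ∑-meet X = begin
    ∑[ C < v ] ∑[ t < v ] (inc t X * inc t C)  ≡⟨ ∑-comm (λ C t → inc t X * inc t C) ⟩
    ∑[ t < v ] ∑[ C < v ] (inc t X * inc t C)  ≡⟨ sum-cong-≗ (λ t → trans (sym (*-distribˡ-sum (inc t X) (inc t)))
                                                                      (cong (inc t X *_) (replication≡k t))) ⟩
    ∑[ t < v ] (inc t X * k)                   ≡⟨ *-distribʳ-sum k (λ t → inc t X) ⟨
    ∑[ t < v ] inc t X * k                     ≡⟨ cong (_* k) (block-size X) ⟩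
    k * k                                      ∎

  ∑-meet² : ∀ X → ∑[ C < v ] (meet X C * meet X C) + k * lam ≡ k * (k * lam + k)
  ∑-meet² X = begin
    ∑[ C < v ] (meet X C * meet X C) + k * lam
      ≡⟨ cong₂ _+_ (∑-gram inc (λ t → inc t X))
                   (trans (cong (_* lam) (sym (block-size X))) (*-distribʳ-sum lam (λ t → inc t X))) ⟩
    ∑[ t < v ] (inc t X * pairsIn t) + ∑[ t < v ] (inc t X * lam)
      ≡⟨ ∑-distrib-+ (λ t → inc t X * pairsIn t) (λ t → inc t X * lam) ⟨
    ∑[ t < v ] (inc t X * pairsIn t + inc t X * lam)
      ≡⟨ sum-cong-≗ (λ t → idempotent-scaling (⟦⟧-idem (I t X)) (row t)) ⟩
    ∑[ t < v ] (inc t X * (k * lam + k))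
      ≡⟨ *-distribʳ-sum (k * lam + k) (λ t → inc t X) ⟨
    ∑[ t < v ] inc t X * (k * lam + k)
      ≡⟨ cong (_* (k * lam + k)) (block-size X) ⟩
    k * (k * lam + k) ∎
    where
    pairsIn : Fin v → ℕ
    pairsIn t = ∑[ t′ < v ] (inc t′ X * blocksThrough t t′)
    row : ∀ t → pairsIn t + inc t X * lam ≡ k * lam + inc t X * k
    row t = trans (∑-except t (λ t′ → inc t′ X) (blocksThrough t) lam
                    (λ t′ t′≢t → cong (inc t′ X *_) (blocksThrough-≢ (t′≢t ∘ sym))))
                  (cong₂ _+_ (cong (_* lam) (block-size X))
                             (cong (inc t X *_) (trans (blocksThrough-self t) (replication≡k t))))

  blocks-meet : ∀ {X Y} → X ≢ Y → meet X Y ≡ lam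
  blocks-meet {X} {Y} X≢Y = ∑-moments-except (meet X) X lam first second Y (X≢Y ∘ sym)
    where
    first : ∑[ C < v ] meet X C + lam ≡ meet X X + v * lam
    first = begin
      ∑[ C < v ] meet X C + lam  ≡⟨ cong (_+ lam) (∑-meet X) ⟩
      k * k + lam                ≡⟨ design-identity X ⟩
      v * lam + k                ≡⟨ +-comm (v * lam) k ⟩
      k + v * lam                ≡⟨ cong (_+ v * lam) (meet-self X) ⟨
      meet X X + v * lam         ∎
    second : ∑[ C < v ] (meet X C * meet X C) + lam * lam ≡ meet X X * meet X X + v * (lam * lam)
    second = trans (second-moment (∑[ C < v ] (meet X C * meet X C)) k lam v (∑-meet² X) (design-identity X))
                   (cong (λ m → m * m + v * (lam * lam)) (sym (meet-self X)))

-- c is the number of neighbours every vertex of Γ* has in each canonical class.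
module Extension {vs m} {A : Adj vs} {cls : Fin vs → Fin m} {I : Fin m → Fin m → Bool} (φ : Fin m ⤖ Fin m)
       {k λ₁ λ₂ n kd ld c K μ : ℕ}
       (ddg : IsDDG A k λ₁ λ₂ m n cls) (design : IsSymDesign I kd ld) (2≤kd : 2 ≤ kd)
       (ddg-condition : n * λ₁ + k ≡ n * λ₂ + λ₁) (m*c≡k : m * c ≡ k)
       (degree-old : k + kd ≡ K) (degree-new : kd * n ≡ K)
       (μ-same : λ₁ + kd ≡ μ) (μ-other : λ₂ + ld ≡ μ) (μ-mixed : kd * c ≡ μ) (μ-new : ld * n ≡ μ) where

  open DivisibleDesignGraph A ddg
  open SymmetricDesign I design 2≤kd

  B : Fin m → Fin m
  B = Bijection.to φ

  E : Fin vs ⊎ Fin m → Fin vs ⊎ Fin m → Bool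
  E = adj⊎ A cls I B

  neighboursIn≡c : ∀ a j → neighboursIn a j ≡ c
  neighboursIn≡c a j = *-cancelˡ-≡ _ _ m {{nonZeroIndex j}} (trans (neighboursIn-uniform ddg-condition a j) (sym m*c≡k))

  ∑-over-blocks : ∀ (h : Fin m → ℕ) → ∑[ j < m ] h (B j) ≡ ∑[ j < m ] h j
  ∑-over-blocks h = sym (∑-permute h (⤖⇒↔ φ))

  ∑-over-classes : ∀ (h : Fin m → ℕ) → ∑[ x < vs ] h (cls x) ≡ ∑[ j < m ] h j * n
  ∑-over-classes h = begin
    ∑[ x < vs ] h (cls x)                             ≡⟨ sum-cong-≗ (λ x → *-identityʳ (h (cls x))) ⟨
    ∑[ x < vs ] (h (cls x) * 1)                       ≡⟨ ∑-fibres cls h (λ _ → 1) ⟩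
    ∑[ j < m ] (h j * ∑[ x < vs ] (δ (cls x) j * 1))  ≡⟨ sum-cong-≗ (λ j → cong (h j *_) class-size′) ⟩
    ∑[ j < m ] (h j * n)                              ≡⟨ *-distribʳ-sum n h ⟨
    ∑[ j < m ] h j * n                                ∎
    where
    class-size′ : ∀ {j} → ∑[ x < vs ] (δ (cls x) j * 1) ≡ n
    class-size′ {j} = trans (sum-cong-≗ (λ x → *-identityʳ (δ (cls x) j))) (class-size j)

  degree⊎ : ∀ s → ∑[ x < vs ] ⟦ E s (inj₁ x) ⟧ + ∑[ t < m ] ⟦ E s (inj₂ t) ⟧ ≡ K
  degree⊎ (inj₁ a) = trans (cong₂ _+_ (degree a) (block-size (B (cls a)))) degree-old
  degree⊎ (inj₂ t) = begin
    ∑[ x < vs ] inc t (B (cls x)) + ∑[ t′ < m ] 0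
      ≡⟨ cong₂ _+_ (∑-over-classes (λ j → inc t (B j))) (sum-replicate-zero m) ⟩
    ∑[ j < m ] inc t (B j) * n + 0
      ≡⟨ +-identityʳ _ ⟩
    ∑[ j < m ] inc t (B j) * n
      ≡⟨ cong (_* n) (trans (∑-over-blocks (inc t)) (replication≡k t)) ⟩
    kd * n
      ≡⟨ degree-new ⟩
    K ∎

  common⊎ : Fin vs ⊎ Fin m → Fin vs ⊎ Fin m → ℕ
  common⊎ s s′ = ∑[ x < vs ] ⟦ E s (inj₁ x) ∧ E s′ (inj₁ x) ⟧ + ∑[ t < m ] ⟦ E s (inj₂ t) ∧ E s′ (inj₂ t) ⟧

  common⊎-comm : ∀ s s′ → common⊎ s s′ ≡ common⊎ s′ s
  common⊎-comm s s′ = cong₂ _+_ (sum-cong-≗ (λ x → cong ⟦_⟧ (∧-comm (E s (inj₁ x)) _)))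
                                (sum-cong-≗ (λ t → cong ⟦_⟧ (∧-comm (E s (inj₂ t)) _)))

  common⊎-old : ∀ {a b} → a ≢ b → common⊎ (inj₁ a) (inj₁ b) ≡ μ
  common⊎-old {a} {b} a≢b with cls a ≟F cls b
  ... | yes same = trans (cong₂ _+_ (sym (count≡∑ (λ x → A a x ∧ A b x))) shared-block)
                         (trans (cong (_+ kd) (common-same a b a≢b same)) μ-same)
    where
    shared-block : ∑[ t < m ] ⟦ I t (B (cls a)) ∧ I t (B (cls b)) ⟧ ≡ kd
    shared-block = trans (sum-cong-≗ (λ t → cong (λ j → ⟦ I t (B (cls a)) ∧ I t (B j) ⟧) (sym same)))
                         (trans (sum-cong-≗ (λ t → cong ⟦_⟧ (∧-idem (I t (B (cls a)))))) (block-size (B (cls a))))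
  ... | no other = trans (cong₂ _+_ (sym (count≡∑ (λ x → A a x ∧ A b x))) two-blocks)
                         (trans (cong (_+ ld) (common-other a b other)) μ-other)
    where
    two-blocks : ∑[ t < m ] ⟦ I t (B (cls a)) ∧ I t (B (cls b)) ⟧ ≡ ld
    two-blocks = trans (sum-cong-≗ (λ t → ⟦∧⟧ (I t (B (cls a))) _))
                       (blocks-meet (other ∘ Bijection.injective φ))

  common⊎-mixed : ∀ a t → common⊎ (inj₁ a) (inj₂ t) ≡ μ
  common⊎-mixed a t = trans (cong₂ _+_ through-classes (∑-∧false (λ t′ → I t′ (B (cls a)))))
                            (trans (+-identityʳ _) μ-mixed)
    where
    through-classes : ∑[ x < vs ] ⟦ A a x ∧ I t (B (cls x)) ⟧ ≡ kd * c
    through-classes = begin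
      ∑[ x < vs ] ⟦ A a x ∧ I t (B (cls x)) ⟧     ≡⟨ sum-cong-≗ (λ x → trans (⟦∧⟧ (A a x) _) (*-comm (adj a x) _)) ⟩
      ∑[ x < vs ] (inc t (B (cls x)) * adj a x)   ≡⟨ ∑-fibres cls (λ j → inc t (B j)) (adj a) ⟩
      ∑[ j < m ] (inc t (B j) * neighboursIn a j) ≡⟨ sum-cong-≗ (λ j → cong (inc t (B j) *_) (neighboursIn≡c a j)) ⟩
      ∑[ j < m ] (inc t (B j) * c)                ≡⟨ *-distribʳ-sum c (λ j → inc t (B j)) ⟨
      ∑[ j < m ] inc t (B j) * c                  ≡⟨ cong (_* c) (trans (∑-over-blocks (inc t)) (replication≡k t)) ⟩
      kd * c                                      ∎

  common⊎-new : ∀ {t t′} → t ≢ t′ → common⊎ (inj₂ t) (inj₂ t′) ≡ μ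
  common⊎-new {t} {t′} t≢t′ = begin
    ∑[ x < vs ] ⟦ I t (B (cls x)) ∧ I t′ (B (cls x)) ⟧ + ∑[ t″ < m ] 0
      ≡⟨ cong₂ _+_ (∑-over-classes (λ j → ⟦ I t (B j) ∧ I t′ (B j) ⟧)) (sum-replicate-zero m) ⟩
    ∑[ j < m ] ⟦ I t (B j) ∧ I t′ (B j) ⟧ * n + 0
      ≡⟨ +-identityʳ _ ⟩
    ∑[ j < m ] ⟦ I t (B j) ∧ I t′ (B j) ⟧ * n
      ≡⟨ cong (_* n) (∑-over-blocks (λ C → ⟦ I t C ∧ I t′ C ⟧)) ⟩
    ∑[ C < m ] ⟦ I t C ∧ I t′ C ⟧ * n
      ≡⟨ cong (_* n) (trans (sum-cong-≗ (λ C → ⟦∧⟧ (I t C) (I t′ C))) (blocksThrough-≢ t≢t′)) ⟩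
    ld * n
      ≡⟨ μ-new ⟩
    μ ∎

  common⊎-distinct : ∀ s s′ → s ≢ s′ → common⊎ s s′ ≡ μ
  common⊎-distinct (inj₁ a) (inj₁ b) s≢s′ = common⊎-old (s≢s′ ∘ cong inj₁)
  common⊎-distinct (inj₁ a) (inj₂ t) _ = common⊎-mixed a t
  common⊎-distinct (inj₂ t) (inj₁ a) _ = trans (common⊎-comm (inj₂ t) (inj₁ a)) (common⊎-mixed a t)
  common⊎-distinct (inj₂ t) (inj₂ t′) s≢s′ = common⊎-new (s≢s′ ∘ cong inj₂)

  E-sym : ∀ s s′ → E s s′ ≡ E s′ s
  E-sym (inj₁ a) (inj₁ b) = proj₁ (proj₁ ddg) a b
  E-sym (inj₁ a) (inj₂ t) = refl
  E-sym (inj₂ t) (inj₁ a) = refl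
  E-sym (inj₂ t) (inj₂ t′) = refl

  E-irrefl : ∀ s → E s s ≡ false
  E-irrefl (inj₁ a) = proj₂ (proj₁ ddg) a
  E-irrefl (inj₂ t) = refl

  count-splitAt : ∀ (P : Fin vs ⊎ Fin m → Bool) →
                  count (λ z → P (splitAt vs z)) ≡ ∑[ x < vs ] ⟦ P (inj₁ x) ⟧ + ∑[ t < m ] ⟦ P (inj₂ t) ⟧
  count-splitAt P = trans (count≡∑ (λ z → P (splitAt vs z))) (∑-splitAt vs m (⟦_⟧ ∘ P))

  splitAt-injective : ∀ {x y} → splitAt vs {m} x ≡ splitAt vs y → x ≡ y
  splitAt-injective {x} {y} eq = trans (sym (join-splitAt vs m x)) (trans (cong (join vs m) eq) (join-splitAt vs m y))

  isSRG : IsSRG (extAdj A cls I B) K μ μ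
  isSRG = ((λ x y → E-sym (splitAt vs x) (splitAt vs y)) , (λ x → E-irrefl (splitAt vs x)))
        , (λ x → trans (count-splitAt (E (splitAt vs x))) (degree⊎ (splitAt vs x)))
        , (λ x y x≢y _ → common≡μ x y x≢y) , (λ x y x≢y _ → common≡μ x y x≢y)
    where
    common≡μ : ∀ x y → x ≢ y → common (extAdj A cls I B) x y ≡ μ
    common≡μ x y x≢y = trans (count-splitAt (λ s → E (splitAt vs x) s ∧ E (splitAt vs y) s))
                           (common⊎-distinct (splitAt vs x) (splitAt vs y) (x≢y ∘ splitAt-injective))

prime-power⇒2≤ : ∀ {q} → IsPrimePower q → 2 ≤ q
prime-power⇒2≤ (p , suc e , p-prime , _ , refl) =
  ≤-trans (nonTrivial⇒n>1 p) (m≤m*n p (p ^ e) {{m^n≢0 p e {{nonTrivial⇒nonZero p}}}})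
  where instance _ = prime⇒nonTrivial p-prime

q^[2d∸1] : ∀ q d → q ^ (2 * suc d ∸ 1) ≡ q ^ suc d * q ^ d
q^[2d∸1] q d = trans (cong (λ x → q ^ (x ∸ 1)) (double d)) (^-distribˡ-+-* q (suc d) d)
  where
  double : ∀ d → 2 * suc d ≡ 1 + (suc d + d)
  double = solve-∀

q^[2d∸2] : ∀ q d → q ^ (2 * suc d ∸ 2) ≡ q ^ d * q ^ d
q^[2d∸2] q d = trans (cong (λ x → q ^ (x ∸ 2)) (double d)) (^-distribˡ-+-* q d d)
  where
  double : ∀ d → 2 * suc d ≡ 2 + (d + d)
  double = solve-∀

q^[2d] : ∀ q d → q ^ (2 * d) ≡ q ^ d * q ^ d
q^[2d] q d = trans (cong (q ^_) (double d)) (^-distribˡ-+-* q d d)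
  where
  double : ∀ d → 2 * d ≡ d + d
  double = solve-∀

-- a = q − 2 and b = q^(d−2) − 1: the truncated differences are written out as polynomials
-- in a and b, so that every parameter identity becomes a job for the ring solver.
record PolynomialForms (q d a b : ℕ) : Set where
  field
    q∸1≡ : q ∸ 1 ≡ 1 + a
    q^[d∸2]≡ : q ^ (d ∸ 2) ≡ 1 + b
    q^[d∸1]≡ : q ^ (d ∸ 1) ≡ (2 + a) * (1 + b)
    q^d≡ : q ^ d ≡ (2 + a) * ((2 + a) * (1 + b))
    q^d∸1≡ : q ^ d ∸ 1 ≡ (1 + a) * (3 + a) + (2 + a) * ((2 + a) * b)
    q^d∸q^[d∸1]∸1≡ : q ^ d ∸ q ^ (d ∸ 1) ∸ 1 ≡ a + (1 + a) * (1 + a) + (1 + a) * ((2 + a) * b)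
    q^[2d∸1]≡ : q ^ (2 * d ∸ 1) ≡ q ^ d * q ^ (d ∸ 1)
    q^[2d∸2]≡ : q ^ (2 * d ∸ 2) ≡ q ^ (d ∸ 1) * q ^ (d ∸ 1)
    q^[2d]∸1≡ : q ^ (2 * d) ∸ 1 ≡ (q ^ d ∸ 1) * (2 + (q ^ d ∸ 1))

polynomialForms : ∀ {q d} → 2 ≤ q → 2 ≤ d → ∃₂ (PolynomialForms q d)
polynomialForms {suc (suc a)} {suc (suc e)} (s≤s (s≤s z≤n)) (s≤s (s≤s z≤n))
  with suc (suc a) ^ e in q^e≡ | m^n>0 (suc (suc a)) e
... | suc b | _ = a , b , record
  { q∸1≡ = refl
  ; q^[d∸2]≡ = q^e≡
  ; q^[d∸1]≡ = cong (q *_) q^e≡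
  ; q^d≡ = q^d≡
  ; q^d∸1≡ = q^d∸1≡
  ; q^d∸q^[d∸1]∸1≡ = begin
      q * (q * q ^ e) ∸ q * q ^ e ∸ 1          ≡⟨ cong (λ t → q * (q * t) ∸ q * t ∸ 1) q^e≡ ⟩
      q * (q * (1 + b)) ∸ q * (1 + b) ∸ 1      ≡⟨ cong (λ x → x ∸ q * (1 + b) ∸ 1) (split a b) ⟩
      q * (1 + b) + (1 + V) ∸ q * (1 + b) ∸ 1  ≡⟨ cong (_∸ 1) (m+n∸m≡n (q * (1 + b)) (1 + V)) ⟩
      V                                        ∎
  ; q^[2d∸1]≡ = q^[2d∸1] q (suc e)
  ; q^[2d∸2]≡ = q^[2d∸2] q (suc e)
  ; q^[2d]∸1≡ = begin
      q ^ (2 * d) ∸ 1                 ≡⟨ cong (_∸ 1) (q^[2d] q d) ⟩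
      q ^ d * q ^ d ∸ 1               ≡⟨ cong (λ x → x * x ∸ 1) (trans q^d≡ (expand a b)) ⟩
      (1 + U) * (1 + U) ∸ 1           ≡⟨ square-pred U ⟩
      U * (2 + U)                     ≡⟨ cong (λ u → u * (2 + u)) q^d∸1≡ ⟨
      (q ^ d ∸ 1) * (2 + (q ^ d ∸ 1)) ∎
  }
  where
  q = suc (suc a)
  d = suc (suc e)
  U V : ℕ
  U = (1 + a) * (3 + a) + (2 + a) * ((2 + a) * b)
  V = a + (1 + a) * (1 + a) + (1 + a) * ((2 + a) * b)
  q^d≡ : q ^ d ≡ (2 + a) * ((2 + a) * (1 + b))
  q^d≡ = cong (λ t → q * (q * t)) q^e≡
  expand : ∀ a b → (2 + a) * ((2 + a) * (1 + b)) ≡ 1 + ((1 + a) * (3 + a) + (2 + a) * ((2 + a) * b))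
  expand = solve-∀
  q^d∸1≡ : q ^ d ∸ 1 ≡ U
  q^d∸1≡ = cong (_∸ 1) (trans q^d≡ (expand a b))
  split : ∀ a b → (2 + a) * ((2 + a) * (1 + b)) ≡ (2 + a) * (1 + b) + (1 + (a + (1 + a) * (1 + a) + (1 + a) * ((2 + a) * b)))
  split = solve-∀
  square-pred : ∀ u → u + u * (1 + u) ≡ u * (2 + u)
  square-pred = solve-∀

module ParameterConditions {q d a b : ℕ} (P : PolynomialForms q d a b) where
  open PolynomialForms P

  ddg-condition : q ^ d * (q ^ (d ∸ 1) * (q ^ d ∸ q ^ (d ∸ 1) ∸ 1)) + q ^ (d ∸ 1) * (q ^ d ∸ 1)
                ≡ q ^ d * (q ^ (d ∸ 2) * (q ∸ 1) * (q ^ d ∸ 1)) + q ^ (d ∸ 1) * (q ^ d ∸ q ^ (d ∸ 1) ∸ 1)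
  ddg-condition rewrite q^d∸q^[d∸1]∸1≡ | q^d∸1≡ | q^d≡ | q^[d∸1]≡ | q^[d∸2]≡ | q∸1≡ = solve (a ∷ b ∷ [])

  class-degree : ∀ m → m * (q ∸ 1) ≡ q ^ d ∸ 1 → m * (q ^ (d ∸ 1) * (q ∸ 1)) ≡ q ^ (d ∸ 1) * (q ^ d ∸ 1)
  class-degree m hm = trans (x∙yz≈y∙xz m (q ^ (d ∸ 1)) (q ∸ 1)) (cong (q ^ (d ∸ 1) *_) hm)

  degree-old : q ^ (d ∸ 1) * (q ^ d ∸ 1) + q ^ (d ∸ 1) ≡ q ^ (2 * d ∸ 1)
  degree-old rewrite q^[2d∸1]≡ | q^d∸1≡ | q^d≡ | q^[d∸1]≡ = solve (a ∷ b ∷ [])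

  degree-new : q ^ (d ∸ 1) * q ^ d ≡ q ^ (2 * d ∸ 1)
  degree-new = trans (*-comm (q ^ (d ∸ 1)) (q ^ d)) (sym q^[2d∸1]≡)

  μ-same : q ^ (d ∸ 1) * (q ^ d ∸ q ^ (d ∸ 1) ∸ 1) + q ^ (d ∸ 1) ≡ q ^ (2 * d ∸ 2) * (q ∸ 1)
  μ-same rewrite q^[2d∸2]≡ | q^d∸q^[d∸1]∸1≡ | q^[d∸1]≡ | q∸1≡ = solve (a ∷ b ∷ [])

  μ-other : q ^ (d ∸ 2) * (q ∸ 1) * (q ^ d ∸ 1) + q ^ (d ∸ 2) * (q ∸ 1) ≡ q ^ (2 * d ∸ 2) * (q ∸ 1)
  μ-other rewrite q^[2d∸2]≡ | q^d∸1≡ | q^[d∸1]≡ | q^[d∸2]≡ | q∸1≡ = solve (a ∷ b ∷ [])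

  μ-mixed : q ^ (d ∸ 1) * (q ^ (d ∸ 1) * (q ∸ 1)) ≡ q ^ (2 * d ∸ 2) * (q ∸ 1)
  μ-mixed = trans (sym (*-assoc (q ^ (d ∸ 1)) _ _)) (cong (_* (q ∸ 1)) (sym q^[2d∸2]≡))

  μ-new : q ^ (d ∸ 2) * (q ∸ 1) * q ^ d ≡ q ^ (2 * d ∸ 2) * (q ∸ 1)
  μ-new rewrite q^[2d∸2]≡ | q^d≡ | q^[d∸1]≡ | q^[d∸2]≡ | q∸1≡ = solve (a ∷ b ∷ [])

  2≤q^[d∸1] : 2 ≤ q ^ (d ∸ 1)
  2≤q^[d∸1] rewrite q^[d∸1]≡ = ≤-trans (m≤m+n 2 a) (m≤m*n (2 + a) (1 + b))

  vertex-count : ∀ m → m * (q ∸ 1) ≡ q ^ d ∸ 1 → (m * q ^ d + m) * (q ∸ 1) ≡ q ^ (2 * d) ∸ 1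
  vertex-count m hm = begin
    (m * q ^ d + m) * (q ∸ 1)        ≡⟨ factor m (q ^ d) (q ∸ 1) ⟩
    m * (q ∸ 1) * (1 + q ^ d)        ≡⟨ cong (_* (1 + q ^ d)) hm ⟩
    (q ^ d ∸ 1) * (1 + q ^ d)        ≡⟨ cong (λ x → (q ^ d ∸ 1) * (1 + x)) (m+[n∸m]≡n 1≤q^d) ⟨
    (q ^ d ∸ 1) * (2 + (q ^ d ∸ 1))  ≡⟨ q^[2d]∸1≡ ⟨
    q ^ (2 * d) ∸ 1                  ∎
    where
    factor : ∀ m x p → (m * x + m) * p ≡ m * p * (1 + x)
    factor = solve-∀
    1≤q^d : 1 ≤ q ^ d
    1≤q^d rewrite q^d≡ = s≤s z≤n

theorem2 : (q d : ℕ) → IsPrimePower q → 2 ≤ d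
    → (m vs : ℕ) → m * (q ∸ 1) ≡ q ^ d ∸ 1 → vs ≡ m * q ^ d
    → (A : Adj vs) (cls : Fin vs → Fin m)
    → IsDDG A (q ^ (d ∸ 1) * (q ^ d ∸ 1)) (q ^ (d ∸ 1) * (q ^ d ∸ q ^ (d ∸ 1) ∸ 1))
        (q ^ (d ∸ 2) * (q ∸ 1) * (q ^ d ∸ 1)) m (q ^ d) cls
    → (I : Fin m → Fin m → Bool) → IsSymDesign I (q ^ (d ∸ 1)) (q ^ (d ∸ 2) * (q ∸ 1))
    → (φ : Fin m ⤖ Fin m)
    → ((vs + m) * (q ∸ 1) ≡ q ^ (2 * d) ∸ 1)
      × IsSRG (extAdj A cls I (Bijection.to φ)) (q ^ (2 * d ∸ 1))
          (q ^ (2 * d ∸ 2) * (q ∸ 1)) (q ^ (2 * d ∸ 2) * (q ∸ 1))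
theorem2 q d prime-power 2≤d m _ hm refl A cls ddg I design φ
  with polynomialForms (prime-power⇒2≤ prime-power) 2≤d
... | _ , _ , forms = vertex-count m hm
                    , Extension.isSRG φ ddg design 2≤q^[d∸1] ddg-condition (class-degree m hm)
                        degree-old degree-new μ-same μ-other μ-mixed μ-new
  where open ParameterConditions forms
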